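{- No flow clutter of a signed graph is isomorphic to a degenerate projective plane. Moreover, for $k\ge 3$, no degenerate projective plane of order $k$ is isomorphic to a clutter obtained from a flow clutter $\mathcal F$ of a signed graph $G=(V,E^+,E^-)$ by contraction of all negative edges (i.e. the clutter $\mathcal F/E^-$, whose members are the positive paths $C\setminus E^-$ for flows $C$).
   Context: A signed graph $G=(V,E^+,E^-)$ is a (multi)graph with edge set $E=E^+\cup E^-$ partitioned into positive and negative edges. A circuit is a cycle without repeated vertices (as an edge set); a flow is a circuit with exactly one negative edge. The flow clutter $\mathcal F$ is the family of edge sets of flows of $G$, ground set $E$. A clutter is a family of subsets of a finite ground set none of which contains another; contraction of an element $e$ replaces the family by the inclusion-minimal sets among $\{C\setminus\{e\}\}$ on ground set without $e$. Two clutters are isomorphic if there is a bijection of ground sets mapping members onto members. For $k\ge 2$, the degenerate projective plane of order $k$ is the clutter $\{\{1,\dots,k\},\{0,1\},\{0,2\},\dots,\{0,k\}\}$ on ground set $\{0,1,\dots,k\}$. -}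

module Defs where

open import Data.Nat using (ℕ; zero; suc; _+_; _≤_)
open import Data.Nat.DivMod using (_mod_)
open import Data.Fin using (Fin; zero; suc; toℕ)
open import Data.Fin.Subset using (Subset; _∈_; _⊆_; _─_; ∁; _∩_; _∪_; ∣_∣; ⁅_⁆; ⊤)
open import Data.Vec using (tabulate; lookup)
open import Data.Bool using (Bool; true; false)
open import Data.Product using (Σ; ∃; _×_; _,_)
open import Data.Sum using (_⊎_)
open import Relation.Binary.PropositionalEquality using (_≡_; _≢_)
open import Function.Definitions using (Injective)
open import Function.Bundles using (_⇔_)

-- A signed (multi)graph with vertex set Fin n and edge set Fin m.
-- Each edge has two (unordered) endpoints (equal endpoints = loop)
-- and a sign: neg e ≡ true iff e ∈ E⁻.
record SignedGraph (n m : ℕ) : Set where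
  field
    ends : Fin m → Fin n × Fin n
    neg  : Fin m → Bool

open SignedGraph public

Neg : ∀ {n m} → SignedGraph n m → Subset m
Neg G = tabulate (neg G)

next : ∀ {l} → Fin (suc l) → Fin (suc l)
next {l} i = (suc (toℕ i)) mod (suc l)

Joins : ∀ {n m} → SignedGraph n m → Fin m → Fin n → Fin n → Set
Joins G e a b = ends G e ≡ (a , b) ⊎ ends G e ≡ (b , a)

-- S is (the edge set of) a circuit: a closed walk v₀ e₀ v₁ e₁ … v_l e_l v₀
-- of length l+1 ≥ 1 with pairwise distinct vertices and pairwise distinct
-- edges, e_i joining v_i and v_{i+1 mod (l+1)}; S is its edge set.
IsCircuit : ∀ {n m} → SignedGraph n m → Subset m → Set
IsCircuit {n} {m} G S =
  Σ ℕ λ l → Σ (Fin (suc l) → Fin n) λ vs → Σ (Fin (suc l) → Fin m) λ es →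
    Injective _≡_ _≡_ vs × Injective _≡_ _≡_ es ×
    (∀ i → Joins G (es i) (vs i) (vs (next i))) ×
    (∀ e → e ∈ S ⇔ (∃ λ i → es i ≡ e))

IsFlow : ∀ {n m} → SignedGraph n m → Subset m → Set
IsFlow G S = IsCircuit G S × ∣ S ∩ Neg G ∣ ≡ 1

-- the flow clutter F of G (ground set: all edges)
FlowClutter : ∀ {n m} → SignedGraph n m → Subset m → Set
FlowClutter G = IsFlow G

PosPart : ∀ {n m} → SignedGraph n m → Subset m → Set
PosPart G T = ∃ λ C → IsFlow G C × T ≡ (C ─ Neg G)

-- F / E⁻ : inclusion-minimal sets among { C ∖ E⁻ : C flow }
-- (its ground set is E⁺ = ∁ (Neg G))
ContractNeg : ∀ {n m} → SignedGraph n m → Subset m → Set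
ContractNeg G T = PosPart G T × (∀ T' → PosPart G T' → T' ⊆ T → T' ≡ T)

-- degenerate projective plane of order k on ground set {0,…,k} = Fin (suc k)
line : ∀ k → Subset (suc k)
line k = tabulate λ { zero → false ; (suc _) → true }

DPP : ∀ k → Subset (suc k) → Set
DPP k S = S ≡ line k ⊎ (∃ λ (i : Fin k) → S ≡ (⁅ zero ⁆ ∪ ⁅ suc i ⁆))

preimage : ∀ {k m} → (Fin k → Fin m) → Subset m → Subset k
preimage σ T = tabulate λ i → lookup T (σ i)

-- A clutter A on ground set Fin k is isomorphic to a clutter B whose ground
-- set is P ⊆ Fin m (members of B are subsets of P): a bijection
-- σ : Fin k → P mapping members of A exactly onto members of B.
Isomorphic : ∀ {k m} → (Subset k → Set) → (P : Subset m) → (Subset m → Set) → Set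
Isomorphic {k} {m} A P B =
  Σ (Fin k → Fin m) λ σ →
    Injective _≡_ _≡_ σ ×
    (∀ e → e ∈ P ⇔ (∃ λ i → σ i ≡ e)) ×
    (∀ T → B T → T ⊆ P) ×
    (∀ T → T ⊆ P → (B T ⇔ A (preimage σ T)))

module Submission where

-- Let a be the image of the point 0 and b i the images of the other points, so that the members
-- are the pairs {a, b i} and the set L of all other elements.
-- In the flow clutter every member contains exactly one negative edge: if a is negative, every
-- b i is positive and L has no negative edge; if a is positive, every b i is negative and L has
-- at least two.
-- In F / E⁻ the flow behind {a, b i} is a triangle a, b i, f with f negative: b i joins an end of
-- a (its hub) to a vertex off a (its rim), and the chord f joins the rim to the other end of a.
-- The flow C with positive part L contains all b i and hence at least three consecutive positive
-- edges; along them the rim of some b i is joined by another b j to the far end of a, and b j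
-- together with the chord of b i is a two-edge flow whose positive part {b j} is strictly smaller
-- than the member {a, b j}, contradicting minimality.

open import Defs
open import Data.Nat using (ℕ; zero; suc; _+_; _∸_; _≤_; _<_; z≤n; s≤s; NonZero)
open import Data.Nat.Properties
  using (≤-antisym; ≤-trans; <-irrefl; +-comm; +-mono-<; +-cancelʳ-≡; m≢1+n+m; m∸n+n≡m; m<n+o⇒m∸n<o; _<?_; ≮⇒≥)
open import Data.Nat.DivMod using (_%_; %-distribˡ-+; m%n%n≡m%n; m<n⇒m%n≡m; m≤n⇒[n∸m]%m≡n%m)
open import Data.Fin using (Fin; zero; suc; toℕ; _≟_)
open import Data.Fin.Properties using (toℕ<n; toℕ-fromℕ<; suc-injective; injective⇒≤)
open import Data.Fin.Subset
  using (Subset; _∈_; _∉_; _⊆_; _⊂_; _─_; ∁; _∩_; _∪_; ∣_∣; ⁅_⁆; ⊤; Nonempty; inside; outside)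
open import Data.Fin.Subset.Properties
  using (_∈?_; x∈⁅x⁆; x∈⁅y⁆⇒x≡y; x∈⁅y⁆⇔x≡y; x∈p∪q⁺; x∈p∪q⁻; x∈p∩q⁺; x∈p∩q⁻; x∈p∧x∉q⇒x∈p─q; p─q⊆p;
         x∈∁p⇒x∉p; ⊆-antisym; p⊂q⇒∣p∣<∣q∣; ∣⁅x⁆∣≡1; nonempty?; Empty-unique; ∣⊥∣≡0)
import Data.Vec as Vec
open import Data.Vec using (tabulate; here; there)
open import Data.Vec.Properties using (lookup∘tabulate; []=⇒lookup; lookup⇒[]=)
open import Data.Vec.Functional using ([]; _∷_)
open import Data.Bool using (Bool; true)
open import Data.Product using (∃; _×_; _,_; proj₁; proj₂; swap)
open import Data.Product.Properties using (,-injective)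
open import Data.Sum using (_⊎_; inj₁; inj₂; [_,_])
import Data.Sum as Sum
open import Data.Empty using (⊥)
open import Relation.Nullary using (¬_; yes; no; contradiction)
open import Relation.Binary.PropositionalEquality
  using (_≡_; _≢_; refl; sym; trans; cong; subst; subst₂; module ≡-Reasoning)
open import Function.Base using (_∘_)
open import Function.Definitions using (Injective)
open import Function.Bundles using (_⇔_; mk⇔; Equivalence)

open Equivalence using (to; from)

∈-tabulate : ∀ {n} {f : Fin n → Bool} {x} → x ∈ tabulate f ⇔ f x ≡ true
∈-tabulate {f = f} {x} = mk⇔
  (λ x∈f → trans (sym (lookup∘tabulate f x)) ([]=⇒lookup x∈f))
  (λ fx → lookup⇒[]= x (tabulate f) (trans (lookup∘tabulate f x) fx))

∈-preimage : ∀ {k m} (σ : Fin k → Fin m) T {j} → j ∈ preimage σ T ⇔ σ j ∈ T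
∈-preimage σ T {j} = mk⇔
  (λ j∈ → lookup⇒[]= (σ j) T (to ∈-tabulate j∈))
  (λ σj∈ → from ∈-tabulate ([]=⇒lookup σj∈))

x∈p─q⇒x∉q : ∀ {n} {p q : Subset n} {x} → x ∈ p ─ q → x ∉ q
x∈p─q⇒x∉q {p = _ Vec.∷ _} {outside Vec.∷ _} here      ()
x∈p─q⇒x∉q {p = _ Vec.∷ _} {inside  Vec.∷ _} {zero}    ()
x∈p─q⇒x∉q {p = _ Vec.∷ _} {_       Vec.∷ _} (there x∈) (there x∈q) = x∈p─q⇒x∉q x∈ x∈q

x∈⁅y⁆∪⁅z⁆⇔ : ∀ {n} {x y z : Fin n} → x ∈ ⁅ y ⁆ ∪ ⁅ z ⁆ ⇔ (x ≡ y ⊎ x ≡ z)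
x∈⁅y⁆∪⁅z⁆⇔ {y = y} {z} = mk⇔
  (Sum.map (x∈⁅y⁆⇒x≡y y) (x∈⁅y⁆⇒x≡y z) ∘ x∈p∪q⁻ ⁅ y ⁆ ⁅ z ⁆)
  (x∈p∪q⁺ ∘ Sum.map (from x∈⁅y⁆⇔x≡y) (from x∈⁅y⁆⇔x≡y))

⁅x⁆∪⁅y⁆∩p≡⁅y⁆ : ∀ {n} {x y : Fin n} {p} → x ∉ p → y ∈ p → (⁅ x ⁆ ∪ ⁅ y ⁆) ∩ p ≡ ⁅ y ⁆
⁅x⁆∪⁅y⁆∩p≡⁅y⁆ {x = x} {y} {p} x∉p y∈p = ⊆-antisym ⊆⁅y⁆ ⁅y⁆⊆
  where
  ⊆⁅y⁆ : (⁅ x ⁆ ∪ ⁅ y ⁆) ∩ p ⊆ ⁅ y ⁆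
  ⊆⁅y⁆ z∈ with x∈p∩q⁻ (⁅ x ⁆ ∪ ⁅ y ⁆) p z∈
  ... | z∈pair , z∈p with to x∈⁅y⁆∪⁅z⁆⇔ z∈pair
  ...   | inj₁ refl = contradiction z∈p x∉p
  ...   | inj₂ refl = x∈⁅x⁆ y
  ⁅y⁆⊆ : ⁅ y ⁆ ⊆ (⁅ x ⁆ ∪ ⁅ y ⁆) ∩ p
  ⁅y⁆⊆ z∈ with x∈⁅y⁆⇒x≡y y z∈
  ... | refl = x∈p∩q⁺ (from x∈⁅y⁆∪⁅z⁆⇔ (inj₂ refl) , y∈p)

∣p∣≡1⇒Nonempty : ∀ {n} {p : Subset n} → ∣ p ∣ ≡ 1 → Nonempty p
∣p∣≡1⇒Nonempty {n} {p} ∣p∣≡1 with nonempty? p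
... | yes p≠∅ = p≠∅
... | no  p=∅ = contradiction (trans (sym ∣p∣≡1) (trans (cong ∣_∣ (Empty-unique p=∅)) (∣⊥∣≡0 n))) λ ()

∣p∣≡1⇒x≡y : ∀ {n} {p : Subset n} {x y} → ∣ p ∣ ≡ 1 → x ∈ p → y ∈ p → x ≡ y
∣p∣≡1⇒x≡y {p = p} {x} {y} ∣p∣≡1 x∈p y∈p with x ≟ y
... | yes x≡y = x≡y
... | no  x≢y = contradiction (subst₂ _<_ (∣⁅x⁆∣≡1 x) ∣p∣≡1 (p⊂q⇒∣p∣<∣q∣ ⁅x⁆⊂p)) (<-irrefl refl)
  where
  ⁅x⁆⊂p : ⁅ x ⁆ ⊂ p
  ⁅x⁆⊂p = (λ z∈ → subst (_∈ p) (sym (x∈⁅y⁆⇒x≡y x z∈)) x∈p) , y , y∈p , x≢y ∘ sym ∘ x∈⁅y⁆⇒x≡y x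

injective-∷ : ∀ {A : Set} {n} {x : A} {g : Fin n → A} →
              (∀ i → g i ≢ x) → Injective _≡_ _≡_ g → Injective _≡_ _≡_ (x ∷ g)
injective-∷ x∉g g-inj {zero}  {zero}  _  = refl
injective-∷ x∉g g-inj {zero}  {suc j} eq = contradiction (sym eq) (x∉g j)
injective-∷ x∉g g-inj {suc i} {zero}  eq = contradiction eq (x∉g i)
injective-∷ x∉g g-inj {suc i} {suc j} eq = cong suc (g-inj eq)

pair-injective : ∀ {A : Set} {x y : A} → x ≢ y → Injective _≡_ _≡_ (x ∷ y ∷ [])
pair-injective x≢y = injective-∷ (λ { zero → x≢y ∘ sym ; (suc ()) }) (injective-∷ (λ ()) λ { {()} })

injective-⊆-image⇒≤ : ∀ {A : Set} {r s} {g : Fin r → A} {h : Fin s → A} →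
                      Injective _≡_ _≡_ g → (∀ i → ∃ λ j → h j ≡ g i) → r ≤ s
injective-⊆-image⇒≤ {h = h} g-inj cover = injective⇒≤ {f = proj₁ ∘ cover} λ {i} {i′} eq →
  g-inj (trans (sym (proj₂ (cover i))) (trans (cong h eq) (proj₂ (cover i′))))

next^ : ∀ {l} → ℕ → Fin (suc l) → Fin (suc l)
next^ zero    p = p
next^ (suc d) p = next (next^ d p)

[1+m%n]%n≡[1+m]%n : ∀ m n .{{_ : NonZero n}} → suc (m % n) % n ≡ suc m % n
[1+m%n]%n≡[1+m]%n m n = begin
  (1 + m % n) % n         ≡⟨ %-distribˡ-+ 1 (m % n) n ⟩
  (1 % n + m % n % n) % n ≡⟨ cong (λ r → (1 % n + r) % n) (m%n%n≡m%n m n) ⟩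
  (1 % n + m % n) % n     ≡⟨ %-distribˡ-+ 1 m n ⟨
  (1 + m) % n             ∎
  where open ≡-Reasoning

toℕ-next^ : ∀ {l} d (p : Fin (suc l)) → toℕ (next^ d p) ≡ (d + toℕ p) % suc l
toℕ-next^     zero    p = sym (m<n⇒m%n≡m (toℕ<n p))
toℕ-next^ {l} (suc d) p = begin
  toℕ (next (next^ d p))            ≡⟨ toℕ-fromℕ< _ ⟩
  suc (toℕ (next^ d p)) % suc l     ≡⟨ cong (λ r → suc r % suc l) (toℕ-next^ d p) ⟩
  suc ((d + toℕ p) % suc l) % suc l ≡⟨ [1+m%n]%n≡[1+m]%n (d + toℕ p) (suc l) ⟩
  suc (d + toℕ p) % suc l           ∎
  where open ≡-Reasoning

[d+t]%n≢t : ∀ {d t n} .{{_ : NonZero n}} → 0 < d → d < n → t < n → (d + t) % n ≢ t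
[d+t]%n≢t {suc d} {t} {n} _ d<n t<n eq with suc d + t <? n
... | yes d+t<n = m≢1+n+m t (trans (sym eq) (m<n⇒m%n≡m d+t<n))
... | no  d+t≮n = <-irrefl (sym n≡1+d) d<n
  where
  open ≡-Reasoning
  n≤d+t = ≮⇒≥ d+t≮n
  d+t∸n≡t : suc d + t ∸ n ≡ t
  d+t∸n≡t = begin
    suc d + t ∸ n       ≡⟨ m<n⇒m%n≡m (m<n+o⇒m∸n<o (suc d + t) n (+-mono-< d<n t<n)) ⟨
    (suc d + t ∸ n) % n ≡⟨ m≤n⇒[n∸m]%m≡n%m n≤d+t ⟩
    (suc d + t) % n     ≡⟨ eq ⟩
    t                   ∎
  n≡1+d : n ≡ suc d
  n≡1+d = +-cancelʳ-≡ t n (suc d) (begin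
    n + t             ≡⟨ +-comm n t ⟩
    t + n             ≡⟨ cong (_+ n) d+t∸n≡t ⟨
    suc d + t ∸ n + n ≡⟨ m∸n+n≡m n≤d+t ⟩
    suc d + t         ∎)

next^-≢ : ∀ {l d} (p : Fin (suc l)) → 0 < d → d < suc l → next^ d p ≢ p
next^-≢ {d = d} p 0<d d<n eq = [d+t]%n≢t 0<d d<n (toℕ<n p) (trans (sym (toℕ-next^ d p)) (cong toℕ eq))

next≢₃ : (p : Fin 3) → next p ≢ p
next≢₃ p = next^-≢ {d = 1} p (s≤s z≤n) (s≤s (s≤s z≤n))

next²≢₃ : (p : Fin 3) → next (next p) ≢ p
next²≢₃ p = next^-≢ {d = 2} p (s≤s z≤n) (s≤s (s≤s (s≤s z≤n)))

next³≡₃ : (p : Fin 3) → next (next (next p)) ≡ p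
next³≡₃ zero             = refl
next³≡₃ (suc zero)       = refl
next³≡₃ (suc (suc zero)) = refl

module SignedGraphs {n m : ℕ} (G : SignedGraph n m) where

  Joins-sym : ∀ {e x y} → Joins G e x y → Joins G e y x
  Joins-sym = Sum.swap

  Joins-endpoints : ∀ {e x y x′ y′} → Joins G e x y → Joins G e x′ y′ →
                    (x′ ≡ x × y′ ≡ y) ⊎ (x′ ≡ y × y′ ≡ x)
  Joins-endpoints (inj₁ p) (inj₁ q) = inj₁ (,-injective (trans (sym q) p))
  Joins-endpoints (inj₁ p) (inj₂ q) = inj₂ (swap (,-injective (trans (sym q) p)))
  Joins-endpoints (inj₂ p) (inj₁ q) = inj₂ (,-injective (trans (sym q) p))
  Joins-endpoints (inj₂ p) (inj₂ q) = inj₁ (swap (,-injective (trans (sym q) p)))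

  flow-negative-edge : ∀ {C} → IsFlow G C → ∃ λ f → f ∈ C × f ∈ Neg G
  flow-negative-edge {C} (_ , one) with ∣p∣≡1⇒Nonempty one
  ... | f , f∈ = f , x∈p∩q⁻ C (Neg G) f∈

  flow-negative-unique : ∀ {C e f} → IsFlow G C → e ∈ C → e ∈ Neg G → f ∈ C → f ∈ Neg G → e ≡ f
  flow-negative-unique (_ , one) e∈C e∈N f∈C f∈N = ∣p∣≡1⇒x≡y one (x∈p∩q⁺ (e∈C , e∈N)) (x∈p∩q⁺ (f∈C , f∈N))

  digon-isFlow : ∀ {e f x y} → e ∉ Neg G → f ∈ Neg G → x ≢ y → Joins G e x y → Joins G f y x →
                 IsFlow G (⁅ e ⁆ ∪ ⁅ f ⁆)
  digon-isFlow {e} {f} {x} {y} e∉N f∈N x≢y e-joins f-joins =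
    (1 , (x ∷ y ∷ []) , (e ∷ f ∷ []) , pair-injective x≢y , pair-injective e≢f , joins , members) ,
    trans (cong ∣_∣ (⁅x⁆∪⁅y⁆∩p≡⁅y⁆ e∉N f∈N)) (∣⁅x⁆∣≡1 f)
    where
    e≢f : e ≢ f
    e≢f refl = e∉N f∈N
    joins : ∀ i → Joins G ((e ∷ f ∷ []) i) ((x ∷ y ∷ []) i) ((x ∷ y ∷ []) (next i))
    joins zero       = e-joins
    joins (suc zero) = f-joins
    members : ∀ g → g ∈ ⁅ e ⁆ ∪ ⁅ f ⁆ ⇔ (∃ λ i → (e ∷ f ∷ []) i ≡ g)
    members g = mk⇔
      ([ (λ g≡e → zero , sym g≡e) , (λ g≡f → suc zero , sym g≡f) ] ∘ to x∈⁅y⁆∪⁅z⁆⇔)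
      (λ { (zero , refl) → from x∈⁅y⁆∪⁅z⁆⇔ (inj₁ refl) ; (suc zero , refl) → from x∈⁅y⁆∪⁅z⁆⇔ (inj₂ refl) })

  record Triangle (e₁ e₂ e₃ : Fin m) : Set where
    field
      x y z    : Fin n
      x≢y      : x ≢ y
      y≢z      : y ≢ z
      z≢x      : z ≢ x
      e₁-joins : Joins G e₁ x y
      e₂-joins : Joins G e₂ y z
      e₃-joins : Joins G e₃ z x

  Triangle-reverse : ∀ {e₁ e₂ e₃} → Triangle e₁ e₃ e₂ → Triangle e₁ e₂ e₃
  Triangle-reverse t = record
    { x = y ; y = x ; z = z
    ; x≢y = x≢y ∘ sym ; y≢z = z≢x ∘ sym ; z≢x = y≢z ∘ sym
    ; e₁-joins = Joins-sym e₁-joins ; e₂-joins = Joins-sym e₃-joins ; e₃-joins = Joins-sym e₂-joins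
    }
    where open Triangle t

  module _ (vs : Fin 3 → Fin n) (es : Fin 3 → Fin m) (vs-inj : Injective _≡_ _≡_ vs)
           (es-inj : Injective _≡_ _≡_ es) (joins : ∀ i → Joins G (es i) (vs i) (vs (next i))) where

    circuit₃-Triangle : ∀ p → Triangle (es p) (es (next p)) (es (next (next p)))
    circuit₃-Triangle p = record
      { x = vs p ; y = vs (next p) ; z = vs (next (next p))
      ; x≢y = next≢₃ p ∘ sym ∘ vs-inj ; y≢z = next≢₃ (next p) ∘ sym ∘ vs-inj ; z≢x = next²≢₃ p ∘ vs-inj
      ; e₁-joins = joins p
      ; e₂-joins = joins (next p)
      ; e₃-joins = subst (Joins G (es (next (next p))) (vs (next (next p))) ∘ vs) (next³≡₃ p) (joins (next (next p)))
      }

    circuit₃-labelled-Triangle : ∀ {e₂ e₃ p} → (∀ i → es i ≡ es p ⊎ es i ≡ e₂ ⊎ es i ≡ e₃) →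
                                 Triangle (es p) e₂ e₃
    circuit₃-labelled-Triangle {p = p} label with label (next p) | label (next (next p))
    ... | inj₁ q↦p         | _                = contradiction (es-inj q↦p) (next≢₃ p)
    ... | inj₂ (inj₁ refl) | inj₁ r↦p         = contradiction (es-inj r↦p) (next²≢₃ p)
    ... | inj₂ (inj₁ refl) | inj₂ (inj₁ r↦q)  = contradiction (es-inj r↦q) (next≢₃ (next p))
    ... | inj₂ (inj₁ refl) | inj₂ (inj₂ refl) = circuit₃-Triangle p
    ... | inj₂ (inj₂ refl) | inj₁ r↦p         = contradiction (es-inj r↦p) (next²≢₃ p)
    ... | inj₂ (inj₂ refl) | inj₂ (inj₁ refl) = Triangle-reverse (circuit₃-Triangle p)
    ... | inj₂ (inj₂ refl) | inj₂ (inj₂ r↦q)  = contradiction (es-inj r↦q) (next≢₃ (next p))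

  three-edge-circuit⇒Triangle : ∀ {C e₁ e₂ e₃} → IsCircuit G C → e₁ ≢ e₂ → e₂ ≢ e₃ → e₃ ≢ e₁ →
                                (∀ e → e ∈ C ⇔ (e ≡ e₁ ⊎ e ≡ e₂ ⊎ e ≡ e₃)) → Triangle e₁ e₂ e₃
  three-edge-circuit⇒Triangle {C} {e₁} {e₂} {e₃} (l , vs , es , vs-inj , es-inj , joins , members)
                              e₁≢e₂ e₂≢e₃ e₃≢e₁ C≡ =
    of-length (≤-antisym (injective-⊆-image⇒≤ es-inj (locate ∘ label)) (injective-⊆-image⇒≤ edges-inj position))
      vs es vs-inj es-inj joins label (proj₂ (position zero))
    where
    edges : Fin 3 → Fin m
    edges = e₁ ∷ e₂ ∷ e₃ ∷ []
    edges-inj : Injective _≡_ _≡_ edges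
    edges-inj = injective-∷ (λ { zero → e₁≢e₂ ∘ sym ; (suc zero) → e₃≢e₁ }) (pair-injective e₂≢e₃)
    edges∈C : ∀ i → edges i ∈ C
    edges∈C zero             = from (C≡ e₁) (inj₁ refl)
    edges∈C (suc zero)       = from (C≡ e₂) (inj₂ (inj₁ refl))
    edges∈C (suc (suc zero)) = from (C≡ e₃) (inj₂ (inj₂ refl))
    position : ∀ i → ∃ λ p → es p ≡ edges i
    position i = to (members (edges i)) (edges∈C i)
    label : ∀ p → es p ≡ e₁ ⊎ es p ≡ e₂ ⊎ es p ≡ e₃
    label p = to (C≡ (es p)) (from (members (es p)) (p , refl))
    locate : ∀ {g} → g ≡ e₁ ⊎ g ≡ e₂ ⊎ g ≡ e₃ → ∃ λ i → edges i ≡ g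
    locate = [ (λ g≡ → zero , sym g≡) , [ (λ g≡ → suc zero , sym g≡) , (λ g≡ → suc (suc zero) , sym g≡) ] ]
    of-length : ∀ {l} → suc l ≡ 3 → (vs : Fin (suc l) → Fin n) (es : Fin (suc l) → Fin m) →
                Injective _≡_ _≡_ vs → Injective _≡_ _≡_ es → (∀ i → Joins G (es i) (vs i) (vs (next i))) →
                (∀ p → es p ≡ e₁ ⊎ es p ≡ e₂ ⊎ es p ≡ e₃) → ∀ {p} → es p ≡ e₁ → Triangle e₁ e₂ e₃
    of-length refl vs es vs-inj es-inj joins label refl = circuit₃-labelled-Triangle vs es vs-inj es-inj joins label

  flow-triangle : ∀ {C e₁ e₂} → IsFlow G C → ⁅ e₁ ⁆ ∪ ⁅ e₂ ⁆ ≡ C ─ Neg G → e₁ ≢ e₂ →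
                  ∃ λ f → f ∈ Neg G × Triangle e₁ e₂ f
  flow-triangle {C} {e₁} {e₂} C-flow pos≡ e₁≢e₂ =
    f , f∈N ,
    three-edge-circuit⇒Triangle (proj₁ C-flow) e₁≢e₂ (sign-≢ (positive (inj₂ refl))) (sign-≢ (positive (inj₁ refl)) ∘ sym) C≡
    where
    f   = proj₁ (flow-negative-edge C-flow)
    f∈C = proj₁ (proj₂ (flow-negative-edge C-flow))
    f∈N = proj₂ (proj₂ (flow-negative-edge C-flow))
    positive : ∀ {e} → e ≡ e₁ ⊎ e ≡ e₂ → e ∈ C ─ Neg G
    positive = subst (_ ∈_) pos≡ ∘ from x∈⁅y⁆∪⁅z⁆⇔
    sign-≢ : ∀ {e} → e ∈ C ─ Neg G → e ≢ f
    sign-≢ e∈ refl = x∈p─q⇒x∉q e∈ f∈N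
    classify : ∀ {e} → e ∈ C → e ≡ e₁ ⊎ e ≡ e₂ ⊎ e ≡ f
    classify {e} e∈C with e ∈? Neg G
    ... | yes e∈N = inj₂ (inj₂ (flow-negative-unique C-flow e∈C e∈N f∈C f∈N))
    ... | no  e∉N = Sum.map₂ inj₁ (to x∈⁅y⁆∪⁅z⁆⇔ (subst (e ∈_) (sym pos≡) (x∈p∧x∉q⇒x∈p─q e∈C e∉N)))
    C≡ : ∀ e → e ∈ C ⇔ (e ≡ e₁ ⊎ e ≡ e₂ ⊎ e ≡ f)
    C≡ e = mk⇔ classify
      [ p─q⊆p C (Neg G) ∘ positive ∘ inj₁ , [ p─q⊆p C (Neg G) ∘ positive ∘ inj₂ , (λ { refl → f∈C }) ] ]

module DPPCopy {k m} {P : Subset m} {B : Subset m → Set} (σ : Fin (suc k) → Fin m)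
  (σ-inj : Injective _≡_ _≡_ σ) (σ-onto : ∀ e → e ∈ P ⇔ (∃ λ i → σ i ≡ e))
  (B⇔DPP : ∀ T → T ⊆ P → (B T ⇔ DPP k (preimage σ T))) where

  a : Fin m
  a = σ zero

  b : Fin k → Fin m
  b i = σ (suc i)

  short : Fin k → Subset m
  short i = ⁅ a ⁆ ∪ ⁅ b i ⁆

  long : Subset m
  long = P ─ ⁅ a ⁆

  σ∈P : ∀ i → σ i ∈ P
  σ∈P i = from (σ-onto (σ i)) (i , refl)

  a≢b : ∀ i → a ≢ b i
  a≢b i = (λ ()) ∘ σ-inj

  b-inj : Injective _≡_ _≡_ b
  b-inj = suc-injective ∘ σ-inj

  a∈short : ∀ {i} → a ∈ short i
  a∈short = from x∈⁅y⁆∪⁅z⁆⇔ (inj₁ refl)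

  b∈short : ∀ {i} → b i ∈ short i
  b∈short = from x∈⁅y⁆∪⁅z⁆⇔ (inj₂ refl)

  b∈long : ∀ i → b i ∈ long
  b∈long i = x∈p∧x∉q⇒x∈p─q (σ∈P (suc i)) (a≢b i ∘ sym ∘ x∈⁅y⁆⇒x≡y a)

  ∈long⁻ : ∀ {e} → e ∈ long → ∃ λ i → b i ≡ e
  ∈long⁻ {e} e∈ with to (σ-onto e) (p─q⊆p P ⁅ a ⁆ e∈)
  ... | zero  , refl = contradiction (x∈⁅x⁆ a) (x∈p─q⇒x∉q e∈)
  ... | suc i , σi≡e = i , σi≡e

  preimage-short : ∀ i → preimage σ (short i) ≡ ⁅ zero ⁆ ∪ ⁅ suc i ⁆
  preimage-short i = ⊆-antisym
    (from x∈⁅y⁆∪⁅z⁆⇔ ∘ Sum.map σ-inj σ-inj ∘ to x∈⁅y⁆∪⁅z⁆⇔ ∘ to (∈-preimage σ (short i)))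
    (from (∈-preimage σ (short i)) ∘ from x∈⁅y⁆∪⁅z⁆⇔ ∘ Sum.map (cong σ) (cong σ) ∘ to x∈⁅y⁆∪⁅z⁆⇔)

  preimage-long : preimage σ long ≡ line k
  preimage-long = ⊆-antisym (λ {j} → to-line j) (λ {j} → from-line j)
    where
    to-line : ∀ j → j ∈ preimage σ long → j ∈ line k
    to-line zero    a∈ = contradiction (x∈⁅x⁆ a) (x∈p─q⇒x∉q (to (∈-preimage σ long) a∈))
    to-line (suc i) _  = there (from (∈-tabulate {f = λ _ → true}) refl)
    from-line : ∀ j → j ∈ line k → j ∈ preimage σ long
    from-line zero    ()
    from-line (suc i) _  = from (∈-preimage σ long) (b∈long i)

  B-short : ∀ i → B (short i)
  B-short i = from (B⇔DPP (short i) short⊆P) (inj₂ (i , preimage-short i))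
    where
    short⊆P : short i ⊆ P
    short⊆P e∈ with to x∈⁅y⁆∪⁅z⁆⇔ e∈
    ... | inj₁ refl = σ∈P zero
    ... | inj₂ refl = σ∈P (suc i)

  B-long : B long
  B-long = from (B⇔DPP long (p─q⊆p P ⁅ a ⁆)) (inj₁ preimage-long)

module FlowClutterCopy {n m k} (G : SignedGraph n m) (σ : Fin (suc k) → Fin m)
  (σ-inj : Injective _≡_ _≡_ σ) (σ-onto : ∀ e → e ∈ ⊤ ⇔ (∃ λ i → σ i ≡ e))
  (B⇔DPP : ∀ T → T ⊆ ⊤ → (FlowClutter G T ⇔ DPP k (preimage σ T))) where

  open SignedGraphs G
  open DPPCopy σ σ-inj σ-onto B⇔DPP

  b-negative : a ∉ Neg G → ∀ i → b i ∈ Neg G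
  b-negative a∉N i with flow-negative-edge (B-short i)
  ... | f , f∈short , f∈N with to x∈⁅y⁆∪⁅z⁆⇔ f∈short
  ...   | inj₁ refl = contradiction f∈N a∉N
  ...   | inj₂ refl = f∈N

  impossible : ∀ (i j : Fin k) → i ≢ j → ⊥
  impossible i j i≢j with a ∈? Neg G
  ... | no a∉N =
    i≢j (b-inj (flow-negative-unique B-long (b∈long i) (b-negative a∉N i) (b∈long j) (b-negative a∉N j)))
  ... | yes a∈N with flow-negative-edge B-long
  ...   | f , f∈long , f∈N with ∈long⁻ f∈long
  ...     | l , refl = a≢b l (flow-negative-unique (B-short l) a∈short a∈N b∈short f∈N)

module ContractionCopy {n m k} (G : SignedGraph n m) (σ : Fin (suc k) → Fin m)
  (σ-inj : Injective _≡_ _≡_ σ) (σ-onto : ∀ e → e ∈ ∁ (Neg G) ⇔ (∃ λ i → σ i ≡ e))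
  (B⇔DPP : ∀ T → T ⊆ ∁ (Neg G) → (ContractNeg G T ⇔ DPP k (preimage σ T))) where

  open SignedGraphs G
  open DPPCopy σ σ-inj σ-onto B⇔DPP

  σ-positive : ∀ i → σ i ∉ Neg G
  σ-positive i = x∈∁p⇒x∉p (σ∈P i)

  positive≢negative : ∀ {i f} → f ∈ Neg G → σ i ≢ f
  positive≢negative {i} f∈N refl = σ-positive i f∈N

  record Spoke (i : Fin k) : Set where
    field
      chord          : Fin m
      chord-negative : chord ∈ Neg G
      triangle       : Triangle a (b i) chord
    open Triangle triangle public
      renaming (x to far; y to hub; z to rim; x≢y to far≢hub; y≢z to hub≢rim; z≢x to rim≢far;
                e₁-joins to a-joins; e₂-joins to b-joins; e₃-joins to chord-joins)

  open Spoke

  spoke : ∀ i → Spoke i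
  spoke i = let ((C , C-flow , short≡) , _) = B-short i
                (f , f∈N , t) = flow-triangle C-flow short≡ (a≢b i)
            in record { chord = f ; chord-negative = f∈N ; triangle = t }

  no-digon : ∀ {i f x y} → Joins G (b i) x y → Joins G f y x → f ∈ Neg G → x ≢ y → ⊥
  no-digon {i} {f} b-joins f-joins f∈N x≢y =
    a∉digon (p─q⊆p digon (Neg G) (subst (a ∈_) (sym digon≡short) a∈short))
    where
    digon = ⁅ b i ⁆ ∪ ⁅ f ⁆
    digon─N⊆short : digon ─ Neg G ⊆ short i
    digon─N⊆short e∈ with to x∈⁅y⁆∪⁅z⁆⇔ (p─q⊆p digon (Neg G) e∈)
    ... | inj₁ refl = b∈short
    ... | inj₂ refl = contradiction f∈N (x∈p─q⇒x∉q e∈)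
    digon≡short : digon ─ Neg G ≡ short i
    digon≡short = proj₂ (B-short i) _ (digon , digon-isFlow (σ-positive (suc i)) f∈N x≢y b-joins f-joins , refl)
                    digon─N⊆short
    a∉digon : a ∉ digon
    a∉digon = [ a≢b i , positive≢negative f∈N ] ∘ to x∈⁅y⁆∪⁅z⁆⇔

  hub≡hub⊎hub≡far : ∀ {i j} (s : Spoke i) (t : Spoke j) → hub t ≡ hub s ⊎ hub t ≡ far s
  hub≡hub⊎hub≡far s t = Sum.map proj₂ proj₂ (Joins-endpoints (a-joins s) (a-joins t))

  rim≢hub : ∀ {i j} (s : Spoke i) (t : Spoke j) → rim s ≢ hub t
  rim≢hub s t rim≡hub with hub≡hub⊎hub≡far s t
  ... | inj₁ hub≡hub = hub≢rim s (sym (trans rim≡hub hub≡hub))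
  ... | inj₂ hub≡far = rim≢far s (trans rim≡hub hub≡far)

  no-bend-at-rim : ∀ {i j w} (s : Spoke i) (t : Spoke j) → Joins G (b j) (rim s) w → w ≢ hub s → ⊥
  no-bend-at-rim s t J w≢hub with Joins-endpoints (b-joins t) J
  ... | inj₁ (rim≡hub , _) = rim≢hub s t rim≡hub
  ... | inj₂ (_ , w≡hub) with hub≡hub⊎hub≡far s t
  ...   | inj₁ hub≡hub = w≢hub (trans w≡hub hub≡hub)
  ...   | inj₂ hub≡far = no-digon (subst (Joins G _ (rim s)) (trans w≡hub hub≡far) J)
                           (Joins-sym (chord-joins s)) (chord-negative s) (rim≢far s)

  no-spoke-path : ∀ {i₀ i₁ i₂ x₀ x₁ x₂ x₃} → Spoke i₀ → Spoke i₁ → Spoke i₂ →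
                  Joins G (b i₀) x₀ x₁ → Joins G (b i₁) x₁ x₂ → Joins G (b i₂) x₂ x₃ → x₀ ≢ x₂ → x₁ ≢ x₃ → ⊥
  no-spoke-path s₀ s₁ s₂ J₀ J₁ J₂ x₀≢x₂ x₁≢x₃ with Joins-endpoints (b-joins s₀) J₀
  ... | inj₁ (refl , refl) = no-bend-at-rim s₀ s₁ J₁ (x₀≢x₂ ∘ sym)
  ... | inj₂ (refl , refl) with Joins-endpoints (b-joins s₁) J₁
  ...   | inj₁ (x₁≡hub , refl) = no-bend-at-rim s₁ s₂ J₂ (x₁≢x₃ ∘ trans x₁≡hub ∘ sym)
  ...   | inj₂ (x₁≡rim , _)    = rim≢hub s₁ s₀ (sym x₁≡rim)

  long-circuit-impossible : 3 ≤ k → ∀ {C} → IsFlow G C → long ≡ C ─ Neg G → ⊥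
  long-circuit-impossible 3≤k {C} C-flow@((l , vs , es , vs-inj , es-inj , joins , members) , _) long≡ =
    no-spoke-path (spoke _) (spoke _) (spoke _)
      (proj₂ (spoke-at q₀ q₀≢j)) (proj₂ (spoke-at q₁ q₁≢j)) (proj₂ (spoke-at q₂ q₂≢j))
      (q₂≢q₀ ∘ sym ∘ vs-inj) (q₃≢q₁ ∘ sym ∘ vs-inj)
    where
    f   = proj₁ (flow-negative-edge C-flow)
    f∈C = proj₁ (proj₂ (flow-negative-edge C-flow))
    f∈N = proj₂ (proj₂ (flow-negative-edge C-flow))
    j : Fin (suc l)
    j = proj₁ (to (members f) f∈C)
    es∈C : ∀ q → es q ∈ C
    es∈C q = from (members (es q)) (q , refl)
    edge∈C : ∀ i → (f ∷ b) i ∈ C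
    edge∈C zero    = f∈C
    edge∈C (suc i) = p─q⊆p C (Neg G) (subst (b i ∈_) long≡ (b∈long i))
    4≤l+1 : 4 ≤ suc l
    4≤l+1 = ≤-trans (s≤s 3≤k)
      (injective-⊆-image⇒≤ (injective-∷ (λ i → positive≢negative f∈N) b-inj) (λ i → to (members _) (edge∈C i)))
    after : ∀ d p → d ≤ 2 → next^ (suc d) p ≢ p
    after d p d≤2 = next^-≢ p (s≤s z≤n) (≤-trans (s≤s (s≤s d≤2)) 4≤l+1)
    q₀ = next j
    q₁ = next q₀
    q₂ = next q₁
    q₃ = next q₂
    q₀≢j  = after 0 j z≤n
    q₁≢j  = after 1 j (s≤s z≤n)
    q₂≢j  = after 2 j (s≤s (s≤s z≤n))
    q₂≢q₀ = after 1 q₀ (s≤s z≤n)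
    q₃≢q₁ = after 1 q₁ (s≤s z≤n)
    negative-at-j : ∀ {q} → es q ∈ Neg G → q ≡ j
    negative-at-j {q} es∈N =
      es-inj (trans (flow-negative-unique C-flow (es∈C q) es∈N f∈C f∈N) (sym (proj₂ (to (members f) f∈C))))
    spoke-at : ∀ q → q ≢ j → ∃ λ i → Joins G (b i) (vs q) (vs (next q))
    spoke-at q q≢j =
      let (i , bi≡es) = ∈long⁻ (subst (es q ∈_) (sym long≡) (x∈p∧x∉q⇒x∈p─q (es∈C q) (q≢j ∘ negative-at-j)))
      in i , subst (λ e → Joins G e (vs q) (vs (next q))) (sym bi≡es) (joins q)

  impossible : 3 ≤ k → ⊥
  impossible 3≤k = let ((_ , C-flow , long≡) , _) = B-long in long-circuit-impossible 3≤k C-flow long≡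

flowClutter-≇-DPP : (n m : ℕ) (G : SignedGraph n m) (k : ℕ) → 2 ≤ k → ¬ Isomorphic (DPP k) ⊤ (FlowClutter G)
flowClutter-≇-DPP n m G (suc (suc k)) (s≤s (s≤s z≤n)) (σ , σ-inj , σ-onto , _ , B⇔DPP) =
  FlowClutterCopy.impossible G σ σ-inj σ-onto B⇔DPP zero (suc zero) λ ()

contraction-≇-DPP : (n m : ℕ) (G : SignedGraph n m) (k : ℕ) → 3 ≤ k →
                    ¬ Isomorphic (DPP k) (∁ (Neg G)) (ContractNeg G)
contraction-≇-DPP n m G k 3≤k (σ , σ-inj , σ-onto , _ , B⇔DPP) =
  ContractionCopy.impossible G σ σ-inj σ-onto B⇔DPP 3≤k

lemma3 : ((n m : ℕ) (G : SignedGraph n m) (k : ℕ) → 2 ≤ k →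
              ¬ Isomorphic (DPP k) ⊤ (FlowClutter G))
         × ((n m : ℕ) (G : SignedGraph n m) (k : ℕ) → 3 ≤ k →
              ¬ Isomorphic (DPP k) (∁ (Neg G)) (ContractNeg G))
lemma3 = flowClutter-≇-DPP , contraction-≇-DPP
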